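{- Formula equivalence is symmetric: for all formulas $\alpha,\alpha'$, if $\alpha\approx\alpha'$ then $\alpha'\approx\alpha$.
   Context: First-order formulas (atoms $R(t_1,\dots,t_k)$, $\Rightarrow,\wedge,\vee$, $\forall y$, $\exists y$) over variables $x_0,x_1,\dots$. "Not free" is the usual inductive relation; the substitution relation $\alpha[x/t]\equiv\beta$ is inductive: $\alpha[x/x]\equiv\alpha$; $\alpha[x/t]\equiv\alpha$ if $x$ not free in $\alpha$; atoms by term substitution; componentwise for connectives; $(Qx\,\alpha)[x/t]\equiv Qx\,\alpha$ for $Q\in\{\forall,\exists\}$; $(Qy\,\alpha)[x/t]\equiv Qy\,\beta$ if $x\ne y$, $y$ does not occur in $t$, $\alpha[x/t]\equiv\beta$. The relation $\alpha\approx\alpha'$ is defined inductively: $R(ts)\approx R(ts)$; $\alpha\circ\beta\approx\alpha'\circ\beta'$ if $\alpha\approx\alpha'$ and $\beta\approx\beta'$ ($\circ\in\{\Rightarrow,\wedge,\vee\}$); $Qx\,\alpha\approx Qx\,\alpha'$ if $\alpha\approx\alpha'$; for $Q\in\{\forall,\exists\}$: if $y$ is not free in $\alpha$, $\alpha[x/y]\equiv\beta$ and $\beta\approx\beta'$ then $Qx\,\alpha\approx Qy\,\beta'$; and if $\alpha\approx\alpha'$, $y$ is not free in $\alpha'$ and $\alpha'[x/y]\equiv\beta'$ then $Qx\,\alpha\approx Qy\,\beta'$. -}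

module Defs where

open import Data.Nat using (ℕ)
open import Data.List using (List; []; _∷_)
open import Relation.Binary.PropositionalEquality using (_≡_)
open import Relation.Nullary using (¬_)

Var : Set
Var = ℕ

data Term : Set where
  var : Var → Term
  fun : ℕ → List Term → Term

data OccursT (y : Var) : Term → Set
data OccursL (y : Var) : List Term → Set
data OccursT y where
  here : OccursT y (var y)
  inFun : ∀ {f ts} → OccursL y ts → OccursT y (fun f ts)
data OccursL y where
  head : ∀ {t ts} → OccursT y t → OccursL y (t ∷ ts)
  tail : ∀ {t ts} → OccursL y ts → OccursL y (t ∷ ts)

data SubstT (x : Var) (s : Term) : Term → Term → Set
data SubstL (x : Var) (s : Term) : List Term → List Term → Set
data SubstT x s where
  var-eq : SubstT x s (var x) s
  var-ne : ∀ {y} → ¬ (x ≡ y) → SubstT x s (var y) (var y)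
  fun-s  : ∀ {f ts ts'} → SubstL x s ts ts' → SubstT x s (fun f ts) (fun f ts')
data SubstL x s where
  nil-s  : SubstL x s [] []
  cons-s : ∀ {t t' ts ts'} → SubstT x s t t' → SubstL x s ts ts' →
           SubstL x s (t ∷ ts) (t' ∷ ts')

data Quant : Set where
  ∀q ∃q : Quant

data Conn : Set where
  ⇒c ∧c ∨c : Conn

data Formula : Set where
  atom : ℕ → List Term → Formula
  bin  : Conn → Formula → Formula → Formula
  qu   : Quant → Var → Formula → Formula

data Free (y : Var) : Formula → Set where
  free-atom : ∀ {R ts} → OccursL y ts → Free y (atom R ts)
  free-l : ∀ {c α β} → Free y α → Free y (bin c α β)
  free-r : ∀ {c α β} → Free y β → Free y (bin c α β)
  free-q : ∀ {Q x α} → ¬ (x ≡ y) → Free y α → Free y (qu Q x α)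

NotFree : Var → Formula → Set
NotFree y α = ¬ Free y α

data Subst : Formula → Var → Term → Formula → Set where
  s-id     : ∀ {α x} → Subst α x (var x) α
  s-notfree : ∀ {α x t} → NotFree x α → Subst α x t α
  s-atom   : ∀ {R ts ts' x t} → SubstL x t ts ts' → Subst (atom R ts) x t (atom R ts')
  s-bin    : ∀ {c α β α' β' x t} → Subst α x t α' → Subst β x t β' →
             Subst (bin c α β) x t (bin c α' β')
  s-bound  : ∀ {Q x α t} → Subst (qu Q x α) x t (qu Q x α)
  s-q      : ∀ {Q x y α β t} → ¬ (x ≡ y) → ¬ OccursT y t → Subst α x t β →
             Subst (qu Q y α) x t (qu Q y β)

data _≈_ : Formula → Formula → Set where
  ≈-atom : ∀ {R ts} → atom R ts ≈ atom R ts
  ≈-bin  : ∀ {c α β α' β'} → α ≈ α' → β ≈ β' → bin c α β ≈ bin c α' β'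
  ≈-q    : ∀ {Q x α α'} → α ≈ α' → qu Q x α ≈ qu Q x α'
  ≈-renL : ∀ {Q x y α β β'} → NotFree y α → Subst α x (var y) β → β ≈ β' →
           qu Q x α ≈ qu Q y β'
  ≈-renR : ∀ {Q x y α α' β'} → α ≈ α' → NotFree y α' → Subst α' x (var y) β' →
           qu Q x α ≈ qu Q y β'

module Submission where

-- Renaming x to a fresh y is invertible: if y is not free in α and α[x/y] ≡ β,
-- then x is not free in β and β[y/x] ≡ α.  This turns each renaming rule of ≈
-- into the other one, read backwards.

open import Defs
open import Relation.Binary.PropositionalEquality using (_≢_; ≢-sym; refl)
open import Relation.Nullary using (¬_)

≢⇒¬occurs-var : ∀ {x y} → x ≢ y → ¬ OccursT y (var x)
≢⇒¬occurs-var x≢y here = x≢y refl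

¬occurs-var⇒≢ : ∀ {x y} → ¬ OccursT y (var x) → y ≢ x
¬occurs-var⇒≢ y∉x refl = y∉x here

renameT-fresh : ∀ {x y t t'} → ¬ OccursT y t → SubstT x (var y) t t' → ¬ OccursT x t'
renameL-fresh : ∀ {x y ts ts'} → ¬ OccursL y ts → SubstL x (var y) ts ts' → ¬ OccursL x ts'
renameT-fresh y∉t var-eq       here       = y∉t here
renameT-fresh y∉t (var-ne x≢z) here       = x≢z refl
renameT-fresh y∉t (fun-s σ)    (inFun o)  = renameL-fresh (λ o' → y∉t (inFun o')) σ o
renameL-fresh y∉ts (cons-s σ _) (head o)  = renameT-fresh (λ o' → y∉ts (head o')) σ o
renameL-fresh y∉ts (cons-s _ σ) (tail o)  = renameL-fresh (λ o' → y∉ts (tail o')) σ o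

renameT-inverse : ∀ {x y t t'} → ¬ OccursT y t → SubstT x (var y) t t' → SubstT y (var x) t' t
renameL-inverse : ∀ {x y ts ts'} → ¬ OccursL y ts → SubstL x (var y) ts ts' → SubstL y (var x) ts' ts
renameT-inverse y∉t var-eq       = var-eq
renameT-inverse y∉t (var-ne x≢z) = var-ne (¬occurs-var⇒≢ y∉t)
renameT-inverse y∉t (fun-s σ)    = fun-s (renameL-inverse (λ o → y∉t (inFun o)) σ)
renameL-inverse y∉ts nil-s         = nil-s
renameL-inverse y∉ts (cons-s σ τ)  =
  cons-s (renameT-inverse (λ o → y∉ts (head o)) σ) (renameL-inverse (λ o → y∉ts (tail o)) τ)

rename-notFree : ∀ {α x y β} → NotFree y α → Subst α x (var y) β → NotFree x β
rename-notFree y∉α s-id                       = y∉α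
rename-notFree y∉α (s-notfree x∉α)            = x∉α
rename-notFree y∉α (s-atom σ)    (free-atom o) = renameL-fresh (λ o' → y∉α (free-atom o')) σ o
rename-notFree y∉α (s-bin σ _)   (free-l f)    = rename-notFree (λ f' → y∉α (free-l f')) σ f
rename-notFree y∉α (s-bin _ τ)   (free-r f)    = rename-notFree (λ f' → y∉α (free-r f')) τ f
rename-notFree y∉α s-bound       (free-q x≢x _) = x≢x refl
rename-notFree y∉α (s-q _ z∉y σ) (free-q _ f)  =
  rename-notFree (λ f' → y∉α (free-q (¬occurs-var⇒≢ z∉y) f')) σ f

rename-inverse : ∀ {α x y β} → NotFree y α → Subst α x (var y) β → Subst β y (var x) α
rename-inverse y∉α s-id              = s-id
rename-inverse y∉α (s-notfree _)     = s-notfree y∉α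
rename-inverse y∉α (s-atom σ)        = s-atom (renameL-inverse (λ o → y∉α (free-atom o)) σ)
rename-inverse y∉α (s-bin σ τ)       =
  s-bin (rename-inverse (λ f → y∉α (free-l f)) σ) (rename-inverse (λ f → y∉α (free-r f)) τ)
rename-inverse y∉α s-bound           = s-notfree y∉α
rename-inverse y∉α (s-q x≢z z∉y σ)   =
  s-q (≢-sym (¬occurs-var⇒≢ z∉y)) (≢⇒¬occurs-var x≢z)
      (rename-inverse (λ f → y∉α (free-q (¬occurs-var⇒≢ z∉y) f)) σ)

lemma9p1p1 : ∀ {α α' : Formula} → α ≈ α' → α' ≈ α
lemma9p1p1 ≈-atom               = ≈-atom
lemma9p1p1 (≈-bin a≈a' b≈b')    = ≈-bin (lemma9p1p1 a≈a') (lemma9p1p1 b≈b')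
lemma9p1p1 (≈-q a≈a')           = ≈-q (lemma9p1p1 a≈a')
lemma9p1p1 (≈-renL y∉α σ β≈β')  =
  ≈-renR (lemma9p1p1 β≈β') (rename-notFree y∉α σ) (rename-inverse y∉α σ)
lemma9p1p1 (≈-renR α≈α' y∉α' σ) =
  ≈-renL (rename-notFree y∉α' σ) (rename-inverse y∉α' σ) (lemma9p1p1 α≈α')
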